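{- For any non-trivial finite simple connected graph $G$ and path $P_n$, $\gamma_{P,c}(G\,\square\,P_n)\leq \gamma_c(G)$.
   Context: Power domination: for $S\subseteq V(G)$, start with $M(S)=N[S]$ and repeatedly add a vertex $w$ whenever some $v\in M(S)$ has $w$ as its unique neighbour outside $M(S)$; $S$ is a connected power dominating set if the final $M(S)$ is the whole vertex set and $\langle S\rangle$ is connected; $\gamma_{P,c}$ denotes the minimum size of such a set. $\gamma_c(G)$ is the connected domination number. The Cartesian product $G\,\square\,H$ has vertex set $V(G)\times V(H)$, with $(a,b)\sim(x,y)$ iff either $a=x$ and $by\in E(H)$, or $b=y$ and $ax\in E(G)$. $P_n$ is the path on $n$ vertices. -}

module Defs where

open import Data.Nat using (ℕ; suc)
open import Data.Fin using (Fin; toℕ)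
open import Data.Bool using (Bool; false; T)
open import Data.List using (List)
open import Data.List.Membership.Propositional using (_∈_)
open import Data.List.Relation.Unary.Unique.Propositional using (Unique)
open import Data.Product using (Σ; _×_; ∃; ∃-syntax)
open import Data.Sum using (_⊎_)
open import Data.Unit using (⊤)
open import Relation.Binary.PropositionalEquality using (_≡_; _≢_)

record Graph : Set₁ where
  field
    V : Set
    E : V → V → Set
open Graph public

record SimpleGraph (n : ℕ) : Set where
  field
    adj    : Fin n → Fin n → Bool
    sym    : ∀ u v → adj u v ≡ adj v u
    irrefl : ∀ u → adj u u ≡ false
open SimpleGraph public

toGraph : ∀ {n} → SimpleGraph n → Graph
toGraph {n} G = record { V = Fin n ; E = λ u v → T (adj G u v) }

Path : ℕ → Graph
Path n = record
  { V = Fin n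
  ; E = λ i j → (toℕ j ≡ suc (toℕ i)) ⊎ (toℕ i ≡ suc (toℕ j)) }

_□_ : Graph → Graph → Graph
G □ H = record
  { V = V G × V H
  ; E = λ p q → ((Data.Product.proj₁ p ≡ Data.Product.proj₁ q) × E H (Data.Product.proj₂ p) (Data.Product.proj₂ q))
              ⊎ ((Data.Product.proj₂ p ≡ Data.Product.proj₂ q) × E G (Data.Product.proj₁ p) (Data.Product.proj₁ q)) }

data Reach (G : Graph) (P : V G → Set) : V G → V G → Set where
  stay : ∀ {u} → P u → Reach G P u u
  step : ∀ {u v w} → P u → E G u v → Reach G P v w → Reach G P u w

ConnectedOn : (G : Graph) → (V G → Set) → Set
ConnectedOn G P = ∀ u v → P u → P v → Reach G P u v

Connected : Graph → Set
Connected G = ConnectedOn G (λ _ → ⊤)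

InClosedNbhd : (G : Graph) → List (V G) → V G → Set
InClosedNbhd G S v = (v ∈ S) ⊎ (∃[ u ] (u ∈ S × E G u v))

-- Connected dominating set (a set = duplicate-free list).
IsConnectedDominatingSet : (G : Graph) → List (V G) → Set
IsConnectedDominatingSet G S =
  Unique S × (∀ v → InClosedNbhd G S v) × ConnectedOn G (λ v → v ∈ S)

-- Final observed set M(S): least set containing N[S] closed under the
-- propagation rule (if u is observed and w is its unique unobserved
-- neighbour, then w becomes observed).
data Observed (G : Graph) (S : List (V G)) : V G → Set where
  start : ∀ {v} → InClosedNbhd G S v → Observed G S v
  force : ∀ {u w} → Observed G S u → E G u w →
          (∀ x → E G u x → x ≢ w → Observed G S x) → Observed G S w

IsConnectedPowerDominatingSet : (G : Graph) → List (V G) → Set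
IsConnectedPowerDominatingSet G S =
  Unique S × (∀ v → Observed G S v) × ConnectedOn G (λ v → v ∈ S)

-- Place a connected dominating set D of G on the end layer G × {0} of G □ Pₙ.
-- The copy of D stays connected and dominates layer 0. Once all layers up to i
-- are observed, each vertex (v , i) has (v , i+1) as its only unobserved
-- neighbour and forces it, so the observation sweeps the whole path.
module Submission where

open import Defs hiding (sym)
open import Data.Nat using (ℕ; _≤_; zero; suc; z≤n)
open import Data.Nat.Properties
  using (≤-refl; ≤-reflexive; ≤-trans; ≤-pred; n≤1+n; m≤n⇒m<n∨m≡n; suc-injective)
open import Data.Fin using (Fin; toℕ; inject₁) renaming (zero to fzero; suc to fsuc)
open import Data.Fin.Properties using (toℕ-injective; toℕ-inject₁)
open import Data.List using (List; length; map)
open import Data.List.Properties using (length-map)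
open import Data.List.Membership.Propositional using (_∈_)
open import Data.List.Membership.Propositional.Properties using (∈-map⁺; ∈-map⁻)
open import Data.List.Relation.Unary.Unique.Propositional using (Unique)
import Data.List.Relation.Unary.Unique.Propositional.Properties as Unique
open import Data.Product using (Σ; _×_; _,_; proj₁)
open import Data.Sum using (inj₁; inj₂)
open import Data.Empty using (⊥-elim)
open import Function using (_∘_)
open import Relation.Binary.PropositionalEquality
  using (_≡_; _≢_; refl; sym; trans; cong)

module Layer {G H : Graph} (h : V H) {D : List (V G)} where

  inLayer : List (V (G □ H))
  inLayer = map (_, h) D

  inLayer-unique : Unique D → Unique inLayer
  inLayer-unique = Unique.map⁺ (cong proj₁)

  inLayer-connected : ConnectedOn G (_∈ D) → ConnectedOn (G □ H) (_∈ inLayer)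
  inLayer-connected conn p q p∈ q∈ with ∈-map⁻ (_, h) p∈ | ∈-map⁻ (_, h) q∈
  ... | a , a∈ , refl | b , b∈ , refl = reach-inLayer (conn a b a∈ b∈)
    where
    reach-inLayer : ∀ {a b} → Reach G (_∈ D) a b →
                    Reach (G □ H) (_∈ inLayer) (a , h) (b , h)
    reach-inLayer (stay a∈)       = stay (∈-map⁺ _ a∈)
    reach-inLayer (step a∈ e ab) = step (∈-map⁺ _ a∈) (inj₂ (refl , e)) (reach-inLayer ab)

  inLayer-dominates-layer : (∀ v → InClosedNbhd G D v) →
                            ∀ v → InClosedNbhd (G □ H) inLayer (v , h)
  inLayer-dominates-layer dom v with dom v
  ... | inj₁ v∈           = inj₁ (∈-map⁺ _ v∈)
  ... | inj₂ (u , u∈ , e) = inj₂ ((u , h) , ∈-map⁺ _ u∈ , inj₂ (refl , e))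

module _ {G : Graph} {n : ℕ} {S : List (V (G □ Path (suc n)))} where

  LayersObservedUpTo : ℕ → Set
  LayersObservedUpTo m = ∀ v j → toℕ j ≤ m → Observed (G □ Path (suc n)) S (v , j)

  force-next-layer : (i : Fin n) → LayersObservedUpTo (toℕ (inject₁ i)) →
                     ∀ v → Observed (G □ Path (suc n)) S (v , fsuc i)
  force-next-layer i below v =
    force (below v (inject₁ i) ≤-refl) (inj₁ (refl , inj₁ up)) others
    where
    up : toℕ (fsuc i) ≡ suc (toℕ (inject₁ i))
    up = cong suc (sym (toℕ-inject₁ i))

    others : ∀ x → E (G □ Path (suc n)) (v , inject₁ i) x → x ≢ (v , fsuc i) →
             Observed (G □ Path (suc n)) S x
    others (_ , b) (inj₁ (refl , inj₁ b-up)) b≢ =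
      ⊥-elim (b≢ (cong (v ,_) (toℕ-injective (trans b-up (sym up)))))
    others (_ , b) (inj₁ (refl , inj₂ b-down)) _ =
      below v b (≤-trans (n≤1+n (toℕ b)) (≤-reflexive (sym b-down)))
    others (u , _) (inj₂ (refl , _)) _ = below u (inject₁ i) ≤-refl

  layers-observed : (∀ v → Observed (G □ Path (suc n)) S (v , fzero)) →
                    ∀ m → LayersObservedUpTo m
  layers-observed first zero    v fzero    z≤n = first v
  layers-observed first (suc m) v j j≤ with m≤n⇒m<n∨m≡n j≤
  ... | inj₁ j<           = layers-observed first m v j (≤-pred j<)
  layers-observed first (suc m) v (fsuc i) _ | inj₂ j≡ =
    force-next-layer i below v
    where
    below : LayersObservedUpTo (toℕ (inject₁ i))
    below rewrite toℕ-inject₁ i | suc-injective j≡ = layers-observed first m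

corollary2 : ∀ {k} (G : SimpleGraph k) → 2 ≤ k → Connected (toGraph G) →
    ∀ (n : ℕ) → 1 ≤ n →
    (D : List (Fin k)) → IsConnectedDominatingSet (toGraph G) D →
    Σ (List (V (toGraph G □ Path n))) (λ S →
      IsConnectedPowerDominatingSet (toGraph G □ Path n) S × length S ≤ length D)
corollary2 G _ _ (suc n) _ D (unique , dominating , connected) =
  inLayer , (inLayer-unique unique , observed , inLayer-connected connected) ,
  ≤-reflexive (length-map (_, fzero) D)
  where
  open Layer {toGraph G} {Path (suc n)} fzero {D}

  observed : ∀ x → Observed (toGraph G □ Path (suc n)) inLayer x
  observed (v , j) =
    layers-observed (start ∘ inLayer-dominates-layer dominating) (toℕ j) v j ≤-refl
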